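{- Let $(V,F)$ be a near vector space with $(F,\circ)$ commutative, and let $u\in Q(V)\setminus\{0\}$. Then for every $\lambda\in F\setminus\{0\}$ we have $+_u=+_{\lambda u}$ (as binary operations on $F$).
   Context: An $F$-group is a pair $(V,F)$ where $(V,+)$ is a group, $F$ is a set of endomorphisms of $V$ containing the zero map $0$, the identity $1$ and the negation map $-1$, $F\setminus\{0\}$ is a subgroup of the automorphism group of $(V,+)$, and $F$ acts fixed-point-freely: if $\alpha x=\beta x$ with $\alpha,\beta\in F$, $x\in V$, then $\alpha=\beta$ or $x=0$. The quasi-kernel $Q(V)$ is the set of $u\in V$ such that for every $\alpha,\beta\in F$ there is $\gamma\in F$ with $\alpha u+\beta u=\gamma u$. $(V,F)$ is a near vector space if $Q(V)$ generates $(V,+)$. $(F,\circ)$ commutative means $\alpha(\beta(v))=\beta(\alpha(v))$ for all $\alpha,\beta\in F$, $v\in V$. For $u\in Q(V)\setminus\{0\}$ and $\alpha,\beta\in F$, $\alpha+_u\beta$ denotes the unique $\gamma\in F$ with $\alpha u+\beta u=\gamma u$. -}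

module Defs where

open import Level using (Level; _⊔_; suc)
open import Algebra.Bundles using (Group)
open import Data.Product using (Σ; _×_)
open import Data.Sum using (_⊎_)
open import Relation.Nullary using (¬_)

-- F is represented by an index type `Scalars` with an action `_·_`; two
-- elements of F are regarded as equal iff they act as the same map (_≈F_),
-- so F really is a set of endomorphisms of V.
record FGroup (c ℓ f : Level) : Set (suc (c ⊔ ℓ ⊔ f)) where
  field
    V       : Group c ℓ
  open Group V public
  field
    Scalars : Set f
    _·_     : Scalars → Carrier → Carrier
    ·-cong  : ∀ α {x y} → x ≈ y → (α · x) ≈ (α · y)
    ·-hom   : ∀ α x y → (α · (x ∙ y)) ≈ ((α · x) ∙ (α · y))
    0F 1F -1F : Scalars
    0F-act  : ∀ x → (0F · x) ≈ ε
    1F-act  : ∀ x → (1F · x) ≈ x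
    -1F-act : ∀ x → (-1F · x) ≈ (x ⁻¹)

  _≈F_ : Scalars → Scalars → Set (c ⊔ ℓ)
  α ≈F β = ∀ x → (α · x) ≈ (β · x)

  field
    ∘-closed   : ∀ α β → Σ Scalars λ γ → ∀ x → (γ · x) ≈ (α · (β · x))
    inv-closed : ∀ α → ¬ (α ≈F 0F) →
                 Σ Scalars λ β → (∀ x → (β · (α · x)) ≈ x) × (∀ x → (α · (β · x)) ≈ x)
    fpf        : ∀ α β x → (α · x) ≈ (β · x) → (α ≈F β) ⊎ (x ≈ ε)

  SumAt : Carrier → Scalars → Scalars → Scalars → Set ℓ
  SumAt u α β γ = ((α · u) ∙ (β · u)) ≈ (γ · u)

  InQ : Carrier → Set (ℓ ⊔ f)
  InQ u = ∀ α β → Σ Scalars λ γ → SumAt u α β γ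

  data GenQ : Carrier → Set (suc (c ⊔ ℓ ⊔ f)) where
    gen-Q   : ∀ {u} → InQ u → GenQ u
    gen-ε   : GenQ ε
    gen-∙   : ∀ {x y} → GenQ x → GenQ y → GenQ (x ∙ y)
    gen-⁻¹  : ∀ {x} → GenQ x → GenQ (x ⁻¹)
    gen-≈   : ∀ {x y} → x ≈ y → GenQ x → GenQ y

  FCommutative : Set (c ⊔ ℓ ⊔ f)
  FCommutative = ∀ α β v → (α · (β · v)) ≈ (β · (α · v))

record NearVectorSpace (c ℓ f : Level) : Set (suc (c ⊔ ℓ ⊔ f)) where
  field
    fgroup    : FGroup c ℓ f
  open FGroup fgroup public
  field
    generated : ∀ v → GenQ v

module Submission where

open import Defs
open import Level using (Level)
open import Data.Product using (_×_; _,_; proj₁; proj₂)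
open import Relation.Nullary using (¬_)
import Relation.Binary.Reasoning.Setoid as SetoidReasoning

module _ {c ℓ f : Level} (G : FGroup c ℓ f) (comm : FGroup.FCommutative G) where
  open FGroup G
  open SetoidReasoning setoid

  ·-distrib-sum : ∀ lam α β u →
                  ((α · (lam · u)) ∙ (β · (lam · u))) ≈ (lam · ((α · u) ∙ (β · u)))
  ·-distrib-sum lam α β u = begin
    (α · (lam · u)) ∙ (β · (lam · u)) ≈⟨ ∙-cong (comm α lam u) (comm β lam u) ⟩
    (lam · (α · u)) ∙ (lam · (β · u)) ≈⟨ sym (·-hom lam (α · u) (β · u)) ⟩
    lam · ((α · u) ∙ (β · u))         ∎

  SumAt-· : ∀ lam {u α β γ} → SumAt u α β γ → SumAt (lam · u) α β γ
  SumAt-· lam {u} {α} {β} {γ} s = begin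
    (α · (lam · u)) ∙ (β · (lam · u)) ≈⟨ ·-distrib-sum lam α β u ⟩
    lam · ((α · u) ∙ (β · u))         ≈⟨ ·-cong lam s ⟩
    lam · (γ · u)                     ≈⟨ comm lam γ u ⟩
    γ · (lam · u)                     ∎

  SumAt-resp-≈ : ∀ {u v α β γ} → u ≈ v → SumAt u α β γ → SumAt v α β γ
  SumAt-resp-≈ {u} {v} {α} {β} {γ} u≈v s = begin
    (α · v) ∙ (β · v) ≈⟨ ∙-cong (·-cong α (sym u≈v)) (·-cong β (sym u≈v)) ⟩
    (α · u) ∙ (β · u) ≈⟨ s ⟩
    γ · u             ≈⟨ ·-cong γ u≈v ⟩
    γ · v             ∎

  SumAt-·⁻¹ : ∀ lam → ¬ (lam ≈F 0F) → ∀ {u α β γ} →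
              SumAt (lam · u) α β γ → SumAt u α β γ
  SumAt-·⁻¹ lam lam≉0 {u} s = SumAt-resp-≈ (lam⁻¹-lam u) (SumAt-· lam⁻¹ s)
    where
    lam⁻¹ = proj₁ (inv-closed lam lam≉0)

    lam⁻¹-lam : ∀ x → (lam⁻¹ · (lam · x)) ≈ x
    lam⁻¹-lam = proj₁ (proj₂ (inv-closed lam lam≉0))

-- The hypotheses u ∈ Q(V) and u ≠ 0 only make +_u well defined; the relation
-- α u + β u = γ u is preserved under u ↦ λ u without them.
mainTheorem2 : ∀ {c ℓ f : Level} (N : NearVectorSpace c ℓ f) →
    NearVectorSpace.FCommutative N →
    ∀ u → NearVectorSpace.InQ N u → ¬ (NearVectorSpace._≈_ N u (NearVectorSpace.ε N)) →
    ∀ (lam : NearVectorSpace.Scalars N) →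
    ¬ (NearVectorSpace._≈F_ N lam (NearVectorSpace.0F N)) →
    ∀ α β γ →
    (NearVectorSpace.SumAt N u α β γ → NearVectorSpace.SumAt N (NearVectorSpace._·_ N lam u) α β γ)
    × (NearVectorSpace.SumAt N (NearVectorSpace._·_ N lam u) α β γ → NearVectorSpace.SumAt N u α β γ)
mainTheorem2 N comm u _ _ lam lam≉0 α β γ =
  SumAt-· G comm lam , SumAt-·⁻¹ G comm lam lam≉0
  where
  G = NearVectorSpace.fgroup N
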